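{- Let $G$ be a connected graph and let $v\in V(G)$ be a vertex that is not a cut vertex of $G$. Then $$\frac{\chi_d^t(G-v)+\chi_d^t(G/v)}{2}-\deg(v)+1\leq \chi_d^t(G)\leq \frac{\chi_d^t(G-v)+\chi_d^t(G/v)}{2}+2.$$
   Context: All graphs are simple and finite. For a graph with no isolated vertex, a total dominator coloring (TD-coloring) is a proper vertex coloring in which every vertex is adjacent to every vertex of some color class (a class other than its own); $\chi_d^t$ denotes the minimum number of colors in such a coloring. $G-v$ is obtained from $G$ by deleting $v$ and its incident edges. The vertex contraction $G/v$ is obtained from $G$ by deleting $v$ and making the open neighbourhood of $v$ a clique (no parallel edges). Implicitly, every graph whose $\chi_d^t$ appears has no isolated vertex. -}

module Defs where

open import Data.Nat using (ℕ; zero; suc)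
open import Data.Empty using (⊥-elim)
open import Data.Fin using (Fin; punchIn; _≟_)
open import Data.Fin.Properties using (punchIn-injective)
open import Data.Bool using (Bool; true; false; _∨_; _∧_; not; if_then_else_)
open import Data.Bool.Properties using (∨-comm; ∧-comm; ∧-assoc)
open import Data.List using (List; map; allFin)
open import Data.Nat.ListAction using (sum)
open import Data.Product using (Σ; ∃; _×_; _,_)
open import Relation.Nullary using (¬_; does; yes; no)
open import Relation.Binary.PropositionalEquality using (_≡_; _≢_; refl; sym; cong; cong₂)

record Graph (n : ℕ) : Set where
  field
    adj    : Fin n → Fin n → Bool
    adj-sym : ∀ x y → adj x y ≡ adj y x
    irrefl : ∀ x → adj x x ≡ false
open Graph public

Adj : ∀ {n} → Graph n → Fin n → Fin n → Set
Adj G x y = adj G x y ≡ true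

deg : ∀ {n} → Graph n → Fin n → ℕ
deg {n} G v = sum (map (λ u → if adj G v u then 1 else 0) (allFin n))

data Walk {n} (G : Graph n) : Fin n → Fin n → Set where
  here : ∀ {x} → Walk G x x
  step : ∀ {x y z} → Adj G x y → Walk G y z → Walk G x z

Connected : ∀ {n} → Graph n → Set
Connected G = ∀ x y → Walk G x y

NoIsolated : ∀ {n} → Graph n → Set
NoIsolated G = ∀ x → ∃ λ y → Adj G x y

-- G - v : delete v (vertices of G - v are Fin m, embedded by punchIn v)
delete : ∀ {m} → Graph (suc m) → Fin (suc m) → Graph m
delete G v = record
  { adj    = λ x y → adj G (punchIn v x) (punchIn v y)
  ; adj-sym = λ x y → adj-sym G (punchIn v x) (punchIn v y)
  ; irrefl = λ x → irrefl G (punchIn v x)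
  }

-- v is a cut vertex of the connected graph G iff G - v is disconnected
-- (G connected with at least two vertices, so removing v increases the
-- number of components exactly when G - v is disconnected).
IsCutVertex : ∀ {m} → Graph (suc m) → Fin (suc m) → Set
IsCutVertex G v = ¬ Connected (delete G v)

private
  neq : ∀ {m} → Fin m → Fin m → Bool
  neq x y = not (does (x ≟ y))

  neq-sym : ∀ {m} (x y : Fin m) → neq x y ≡ neq y x
  neq-sym x y with x ≟ y | y ≟ x
  ... | yes _ | yes _ = refl
  ... | no _  | no _  = refl
  ... | yes p | no ¬q = ⊥-elim (¬q (sym p))
  ... | no ¬p | yes q = ⊥-elim (¬p (sym q))

  neq-irr : ∀ {m} (x : Fin m) → neq x x ≡ false
  neq-irr x with x ≟ x
  ... | yes _ = refl
  ... | no ¬p = ⊥-elim (¬p refl)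

  conAdj : ∀ {m} → Graph (suc m) → Fin (suc m) → Fin m → Fin m → Bool
  conAdj G v x y =
    adj G (punchIn v x) (punchIn v y)
      ∨ (neq x y ∧ (adj G v (punchIn v x) ∧ adj G v (punchIn v y)))

  conAdj-sym : ∀ {m} (G : Graph (suc m)) v x y → conAdj G v x y ≡ conAdj G v y x
  conAdj-sym G v x y =
    cong₂ _∨_ (adj-sym G (punchIn v x) (punchIn v y))
              (cong₂ _∧_ (neq-sym x y) (∧-comm (adj G v (punchIn v x)) (adj G v (punchIn v y))))

  conAdj-irr : ∀ {m} (G : Graph (suc m)) v x → conAdj G v x x ≡ false
  conAdj-irr G v x rewrite irrefl G (punchIn v x) | neq-irr x = refl

-- G / v : delete v and make its open neighbourhood a clique
contract : ∀ {m} → Graph (suc m) → Fin (suc m) → Graph m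
contract G v = record
  { adj    = conAdj G v
  ; adj-sym = conAdj-sym G v
  ; irrefl = conAdj-irr G v
  }

Proper : ∀ {n} → Graph n → ∀ {k} → (Fin n → Fin k) → Set
Proper G c = ∀ x y → Adj G x y → c x ≢ c y

DominatesClass : ∀ {n} → Graph n → ∀ {k} → (Fin n → Fin k) → Fin n → Fin k → Set
DominatesClass G c x i =
  i ≢ c x × (∃ λ y → c y ≡ i) × (∀ y → c y ≡ i → Adj G x y)

IsTDColoring : ∀ {n} → Graph n → ∀ {k} → (Fin n → Fin k) → Set
IsTDColoring G c = Proper G c × (∀ x → ∃ λ i → DominatesClass G c x i)

HasTDColoring : ∀ {n} → Graph n → ℕ → Set
HasTDColoring {n} G k = Σ (Fin n → Fin k) λ c → IsTDColoring G c

open import Data.Nat using (_<_)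
IsTDChromatic : ∀ {n} → Graph n → ℕ → Set
IsTDChromatic G k = HasTDColoring G k × (∀ j → j < k → ¬ HasTDColoring G j)

-- Both bounds transfer TD-colourings between G and G − v, G/v.
-- Upwards, a TD-colouring of G − v or G/v extends to G with two new colours, one for v and
-- one for a neighbour u of v; hence χ(G) ≤ χ(G − v) + 2 and χ(G) ≤ χ(G/v) + 2.
-- Downwards, a TD-colouring of G induces one of G − v (resp. G/v) once at most deg v vertices
-- get fresh singleton colours, the colour of v being dropped when v alone carries it. The
-- fresh vertices take over the class {v} for the vertices dominating it: a chosen neighbour
-- in G − v of each neighbour of v, resp. the neighbours of v, which form a clique in G/v.
-- Hence χ(G − v), χ(G/v) ≤ χ(G) + deg v − 1, and the four inequalities add up to the claim.
module Submission where

open import Defs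
open import Function using (_∘_; id)
open import Data.Nat using (ℕ; zero; suc; _+_; _*_; _≤_; z≤n; s≤s)
open import Data.Nat.Properties using (≮⇒≥; +-monoʳ-≤; +-suc; ≤-reflexive; +-mono-≤)
open import Data.Nat.Tactic.RingSolver using (solve-∀)
open import Data.Fin using (Fin; zero; suc; punchIn; punchOut; join; splitAt; _↑ʳ_; inject≤; _≟_)
open import Data.Fin.Properties
  using ( suc-injective; punchIn-injective; punchIn-punchOut; punchOut-injective; splitAt-join
        ; ↑ʳ-injective; inject≤-injective; any?)
open import Data.Bool as Bool using (Bool; true; false; _∨_; _∧_; not; if_then_else_)
open import Data.Bool.Properties using (∨-zeroʳ)
open import Data.List using (tabulate)
open import Data.List.Properties using (map-tabulate)
open import Data.Nat.ListAction using (sum)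
open import Data.Vec.Functional using (insertAt)
open import Data.Vec.Functional.Properties using (insertAt-lookup; insertAt-punchIn)
open import Data.Product using (∃; ∃₂; _×_; _,_; proj₁; proj₂)
open import Data.Sum using (_⊎_; inj₁; inj₂)
open import Data.Sum.Properties using (inj₁-injective; inj₂-injective)
open import Data.Empty using (⊥; ⊥-elim)
open import Relation.Nullary using (¬_; Dec; yes; no; does)
open import Relation.Nullary.Decidable using (_×-dec_; ¬?)
open import Relation.Unary using (Decidable)
open import Relation.Binary.PropositionalEquality
  using (_≡_; _≢_; refl; sym; trans; cong; subst; subst₂)

punchIn-cover : ∀ {m} (v x : Fin (suc m)) → x ≡ v ⊎ ∃ λ z → x ≡ punchIn v z
punchIn-cover v x with x ≟ v
... | yes x≡v = inj₁ x≡v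
... | no x≢v = inj₂ (punchOut (x≢v ∘ sym) , sym (punchIn-punchOut _))

join-injective : ∀ k k' {i j : Fin k ⊎ Fin k'} → join k k' i ≡ join k k' j → i ≡ j
join-injective k k' {i} {j} eq =
  trans (sym (splitAt-join k k' i)) (trans (cong (splitAt k) eq) (splitAt-join k k' j))

record Ranking {n} (P : Fin n → Set) (d : ℕ) : Set where
  field
    rank           : ∀ {x} → P x → Fin d
    rank-injective : ∀ {x y} (px : P x) (py : P y) → rank px ≡ rank py → x ≡ y
open Ranking

Ranking-∅ : ∀ {n} → Ranking {n} (λ _ → ⊥) 0
Ranking-∅ = record { rank = λ () ; rank-injective = λ () }

Ranking-∘ : ∀ {m n d} {P : Fin n → Set} {h : Fin m → Fin n} →
  (∀ {x y} → h x ≡ h y → x ≡ y) → Ranking P d → Ranking (P ∘ h) d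
Ranking-∘ h-injective R = record
  { rank           = rank R
  ; rank-injective = λ px py eq → h-injective (rank-injective R px py eq)
  }

Ranking-image : ∀ {m n d} {P : Fin n → Set} (h : Fin n → Fin m) →
  Ranking P d → Ranking (λ w → ∃ λ x → P x × h x ≡ w) d
Ranking-image h R = record
  { rank           = λ { (_ , px , _) → rank R px }
  ; rank-injective = λ { (x , px , refl) (y , py , refl) eq → cong h (rank-injective R px py eq) }
  }

Ranking-punchOut : ∀ {n d} {P : Fin n → Set} {s} → Ranking P (suc d) → P s →
  Ranking (λ x → P x × x ≢ s) d
Ranking-punchOut R ps = record
  { rank           = λ { (px , x≢s) → punchOut (x≢s ∘ sym ∘ rank-injective R ps px) }
  ; rank-injective = λ { (px , x≢s) (py , y≢s) eq →
      rank-injective R px py (punchOut-injective (x≢s ∘ sym ∘ rank-injective R ps px)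
                                                 (y≢s ∘ sym ∘ rank-injective R ps py) eq) }
  }

Ranking-nonempty : ∀ {n d} {P : Fin n → Set} {x} → Ranking P d → P x →
  ∃ λ d' → d ≡ suc d' × Ranking P (suc d')
Ranking-nonempty {d = zero}   R px with () ← rank R px
Ranking-nonempty {d = suc d'} R px = d' , refl , R

count : ∀ {n} → (Fin n → Bool) → ℕ
count p = sum (tabulate (λ x → if p x then 1 else 0))

count-ranking : ∀ {n} (p : Fin n → Bool) → Ranking (λ x → p x ≡ true) (count p)
count-ranking p = record { rank = rank′ p ; rank-injective = rank′-injective p }
  where
  rank′ : ∀ {n} (p : Fin n → Bool) {x} → p x ≡ true → Fin (count p)
  rank′ p {zero} px with p zero
  ... | true = zero
  rank′ p {suc x} px = (if p zero then 1 else 0) ↑ʳ rank′ (p ∘ suc) px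

  rank′-injective : ∀ {n} (p : Fin n → Bool) {x y} (px : p x ≡ true) (py : p y ≡ true) →
    rank′ p px ≡ rank′ p py → x ≡ y
  rank′-injective p {zero} {zero} _ _ _ = refl
  rank′-injective p {zero} {suc y} px py eq with p zero
  ... | true with () ← eq
  rank′-injective p {suc x} {zero} px py eq with p zero
  ... | true with () ← eq
  rank′-injective p {suc x} {suc y} px py eq =
    cong suc (rank′-injective (p ∘ suc) px py (↑ʳ-injective (if p zero then 1 else 0) _ _ eq))

deg≡count : ∀ {n} (G : Graph n) v → deg G v ≡ count (adj G v)
deg≡count G v = cong sum (map-tabulate id (λ u → if adj G v u then 1 else 0))

neighbourhood-ranking : ∀ {n} (G : Graph n) v {x} → Adj G v x →
  ∃ λ d → deg G v ≡ suc d × Ranking (Adj G v) (suc d)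
neighbourhood-ranking G v a =
  Ranking-nonempty (subst (Ranking (Adj G v)) (sym (deg≡count G v)) (count-ranking (adj G v))) a

Adj-irrefl : ∀ {n} (G : Graph n) {x} → ¬ Adj G x x
Adj-irrefl G {x} a with () ← trans (sym a) (irrefl G x)

Adj-sym : ∀ {n} (G : Graph n) {x y} → Adj G x y → Adj G y x
Adj-sym G {x} {y} a = trans (adj-sym G y x) a

Adj? : ∀ {n} (G : Graph n) x y → Dec (Adj G x y)
Adj? G x y = adj G x y Bool.≟ true

punchIn-neighbour : ∀ {m} (G : Graph (suc m)) v → ∃ (Adj G v) → ∃ λ u → Adj G v (punchIn v u)
punchIn-neighbour G v (y , a) with punchIn-cover v y
... | inj₁ refl = ⊥-elim (Adj-irrefl G a)
... | inj₂ (u , refl) = u , a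

module _ {m} (G : Graph (suc m)) (v : Fin (suc m)) where

  delete⇒contract : ∀ {x y} → Adj (delete G v) x y → Adj (contract G v) x y
  delete⇒contract {x} {y} a rewrite a = refl

  common⇒contract : ∀ {x y} → x ≢ y → Adj G v (punchIn v x) → Adj G v (punchIn v y) →
    Adj (contract G v) x y
  common⇒contract {x} {y} x≢y ax ay with x ≟ y
  ... | yes x≡y = ⊥-elim (x≢y x≡y)
  ... | no _ rewrite ax | ay = ∨-zeroʳ _

  contract⇒delete⊎common : ∀ {x y} → Adj (contract G v) x y →
    Adj (delete G v) x y ⊎ (Adj G v (punchIn v x) × Adj G v (punchIn v y))
  contract⇒delete⊎common {x} {y} =
    split (adj G (punchIn v x) (punchIn v y)) (not (does (x ≟ y)))
          (adj G v (punchIn v x)) (adj G v (punchIn v y))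
    where
    split : ∀ p q r s → p ∨ (q ∧ (r ∧ s)) ≡ true → p ≡ true ⊎ (r ≡ true × s ≡ true)
    split true  _     _     _     _ = inj₁ refl
    split false true  true  true  _ = inj₂ (refl , refl)
    split false true  true  false ()
    split false true  false _     ()
    split false false _     _     ()

dominates-unique : ∀ {n k} {G : Graph n} {g : Fin n → Fin k} {x w} → Proper G g →
  Adj G x w → (∀ {y} → g y ≡ g w → y ≡ w) → DominatesClass G g x (g w)
dominates-unique {G = G} {x = x} proper a unique =
  (λ eq → proper _ _ a (sym eq)) , (_ , refl) , λ y e → subst (Adj G x) (sym (unique e)) a

IsTDColoring-∘ : ∀ {n k k'} {G : Graph n} {g : Fin n → Fin k} {e : Fin k → Fin k'} →
  (∀ {i j} → e i ≡ e j → i ≡ j) → IsTDColoring G g → IsTDColoring G (e ∘ g)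
IsTDColoring-∘ {e = e} e-injective (proper , dominate) =
  (λ x y a → proper x y a ∘ e-injective) ,
  λ x → let (i , i≢ , (y , y∈i) , all) = dominate x in
        e i , i≢ ∘ e-injective , (y , cong e y∈i) , λ y′ → all y′ ∘ e-injective

HasTDColoring-mono : ∀ {n k k'} {G : Graph n} → k ≤ k' → HasTDColoring G k → HasTDColoring G k'
HasTDColoring-mono {G = G} k≤k' (g , g-td) =
  (λ x → inject≤ (g x) k≤k') ,
  IsTDColoring-∘ {G = G} (λ {i} {j} → inject≤-injective k≤k' k≤k' i j) g-td

HasTDColoring-resp : ∀ {n k} {H H' : Graph n} →
  (∀ {x y} → Adj H x y → Adj H' x y) → (∀ {x y} → Adj H' x y → Adj H x y) →
  HasTDColoring H k → HasTDColoring H' k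
HasTDColoring-resp H⇒H' H'⇒H (g , proper , dominate) =
  g , (λ x y → proper x y ∘ H'⇒H) ,
  λ x → let (i , i≢ , nonempty , all) = dominate x in i , i≢ , nonempty , λ y → H⇒H' ∘ all y

IsTDChromatic-minimal : ∀ {n a k} {G : Graph n} → IsTDChromatic G a → HasTDColoring G k → a ≤ k
IsTDChromatic-minimal (_ , minimal) h = ≮⇒≥ (λ k<a → minimal _ k<a h)

-- Vertices in Fresh get pairwise distinct new colours. A vertex whose f-dominated class
-- was {v} is rescued by a fresh neighbour, whose new colour class is a singleton.
module Recolouring {m c k k'} {G : Graph (suc m)} {v : Fin (suc m)} {f : Fin (suc m) → Fin c}
  (f-td : IsTDColoring G f) (H : Graph m)
  {Fresh : Fin m → Set} (fresh? : Decidable Fresh) (new : Ranking Fresh k')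
  (old : Fin m → Fin k)
  (old-reflects : ∀ {z z'} → old z ≡ old z' → f (punchIn v z) ≡ f (punchIn v z'))
  (edge-kept : ∀ {x y} → Adj G (punchIn v x) (punchIn v y) → Adj H x y)
  (stale-edge : ∀ {x y} → ¬ Fresh x → ¬ Fresh y → Adj H x y → Adj G (punchIn v x) (punchIn v y))
  (rescue : (∀ z → f (punchIn v z) ≢ f v) →
            ∀ {y} → Adj G (punchIn v y) v → ∃ λ w → Fresh w × Adj H y w)
  where

  colour : Fin m → Fin k ⊎ Fin k'
  colour z with fresh? z
  ... | yes p = inj₂ (rank new p)
  ... | no _  = inj₁ (old z)

  g : Fin m → Fin (k + k')
  g = join k k' ∘ colour

  fresh-unique : ∀ {z z'} → Fresh z → g z' ≡ g z → z' ≡ z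
  fresh-unique {z} {z'} p eq
    with fresh? z | fresh? z' | join-injective k k' {colour z'} {colour z} eq
  ... | yes p₁ | yes p₂ | same = rank-injective new p₂ p₁ (inj₂-injective same)
  ... | yes _  | no _   | ()
  ... | no ¬p  | _      | _ = ⊥-elim (¬p p)

  stale-reflects : ∀ {z z'} → ¬ Fresh z → ¬ Fresh z' → g z ≡ g z' →
    f (punchIn v z) ≡ f (punchIn v z')
  stale-reflects {z} {z'} ¬p ¬p′ eq
    with fresh? z | fresh? z' | join-injective k k' {colour z} {colour z'} eq
  ... | no _  | no _  | same = old-reflects (inj₁-injective same)
  ... | yes p | _     | _ = ⊥-elim (¬p p)
  ... | no _  | yes p | _ = ⊥-elim (¬p′ p)

  proper : Proper H g
  proper x y a eq = separate (fresh? x) (fresh? y)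
    where
    separate : Dec (Fresh x) → Dec (Fresh y) → ⊥
    separate (yes p) _       = Adj-irrefl H (subst (Adj H x) (fresh-unique p (sym eq)) a)
    separate (no _)  (yes q) = Adj-irrefl H (subst (Adj H x) (sym (fresh-unique q eq)) a)
    separate (no ¬p) (no ¬q) = proj₁ f-td _ _ (stale-edge ¬p ¬q a) (stale-reflects ¬p ¬q eq)

  dominates-stale : ∀ {y z i} → ¬ Fresh z → f (punchIn v z) ≡ i → i ≢ f (punchIn v y) →
    (∀ x → f x ≡ i → Adj G (punchIn v y) x) → DominatesClass H g y (g z)
  dominates-stale {y} {z} ¬p z∈i i≢ adj-i =
    distinct (fresh? y) , (z , refl) , λ y′ → member y′ (fresh? y′)
    where
    distinct : Dec (Fresh y) → g z ≢ g y
    distinct (yes q) eq = ¬p (subst Fresh (sym (fresh-unique q eq)) q)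
    distinct (no ¬q) eq = i≢ (trans (sym z∈i) (stale-reflects ¬p ¬q eq))
    member : ∀ y′ → Dec (Fresh y′) → g y′ ≡ g z → Adj H y y′
    member y′ (yes q) eq = ⊥-elim (¬p (subst Fresh (sym (fresh-unique q (sym eq))) q))
    member y′ (no ¬q) eq = edge-kept (adj-i _ (trans (stale-reflects ¬q ¬p eq) z∈i))

  dominate : ∀ y → ∃ (DominatesClass H g y)
  dominate y with proj₂ f-td (punchIn v y)
  ... | i , i≢ , (x₀ , x₀∈i) , adj-i with any? (λ z → f (punchIn v z) ≟ i)
  ...   | yes (z , z∈i) = via (fresh? z)
    where
    via : Dec (Fresh z) → ∃ (DominatesClass H g y)
    via (yes p) = g z , dominates-unique {G = H} proper (edge-kept (adj-i _ z∈i)) (fresh-unique p)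
    via (no ¬p) = g z , dominates-stale ¬p z∈i i≢ adj-i
  ...   | no outside = via-rescue (rescue (λ z eq → outside (z , trans eq v∈i)) (adj-i v v∈i))
    where
    v∈i : f v ≡ i
    v∈i with punchIn-cover v x₀
    ... | inj₁ refl = x₀∈i
    ... | inj₂ (z , refl) = ⊥-elim (outside (z , x₀∈i))
    via-rescue : ∃ (λ w → Fresh w × Adj H y w) → ∃ (DominatesClass H g y)
    via-rescue (w , p , y~w) = g w , dominates-unique {G = H} proper y~w (fresh-unique p)

  hasTDColoring : HasTDColoring H (k + k')
  hasTDColoring = g , proper , dominate

module LowerBound {m d} (G : Graph (suc m)) (v : Fin (suc m)) (N : Ranking (Adj G v) (suc d))
  (u₀ : Fin m) (u₀-adj : Adj G v (punchIn v u₀)) where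

  private
    punchIn-inj : ∀ {x y} → punchIn v x ≡ punchIn v y → x ≡ y
    punchIn-inj = punchIn-injective v _ _

    Neighbour : Fin m → Set
    Neighbour z = Adj G v (punchIn v z)

  module _ {c} {f : Fin (suc m) → Fin (suc c)} (unique : ∀ z → f (punchIn v z) ≢ f v) where

    dropColour : Fin m → Fin c
    dropColour z = punchOut (unique z ∘ sym)

    dropColour-reflects : ∀ {z z'} → dropColour z ≡ dropColour z' →
      f (punchIn v z) ≡ f (punchIn v z')
    dropColour-reflects {z} {z'} = punchOut-injective (unique z ∘ sym) (unique z' ∘ sym)

  delete-shared : ∀ {c} {f : Fin (suc m) → Fin c} → IsTDColoring G f →
    ∃ (λ u → f (punchIn v u) ≡ f v) → HasTDColoring (delete G v) (c + 0)
  delete-shared {f = f} f-td (u , shared) =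
    Recolouring.hasTDColoring {G = G} {v = v} {f = f} f-td (delete G v) (λ _ → no id) Ranking-∅
      (f ∘ punchIn v) id id (λ _ _ → id) (λ unique → ⊥-elim (unique u shared))

  delete-unique : ∀ {c} {f : Fin (suc m) → Fin (suc c)} → IsTDColoring G f →
    (∀ z → f (punchIn v z) ≢ f v) → NoIsolated (delete G v) →
    HasTDColoring (delete G v) (c + suc d)
  delete-unique {f = f} f-td unique D-noIso =
    Recolouring.hasTDColoring {G = G} {v = v} {f = f} f-td (delete G v)
      (λ w → any? (λ x → Adj? G v (punchIn v x) ×-dec (partner x ≟ w)))
      (Ranking-image partner (Ranking-∘ punchIn-inj N))
      (dropColour {f = f} unique) (dropColour-reflects {f = f} unique) id (λ _ _ → id)
      (λ _ {y} y~v → partner y , (y , Adj-sym G y~v , refl) , proj₂ (D-noIso y))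
    where
    partner : Fin m → Fin m
    partner x = proj₁ (D-noIso x)

  contract-shared : ∀ {c} {f : Fin (suc m) → Fin c} → IsTDColoring G f →
    ∃ (λ u → f (punchIn v u) ≡ f v) → HasTDColoring (contract G v) (c + d)
  contract-shared {f = f} f-td (u , shared) =
    Recolouring.hasTDColoring {G = G} {v = v} {f = f} f-td (contract G v)
      fresh? (Ranking-∘ punchIn-inj (Ranking-punchOut N u₀-adj)) (f ∘ punchIn v) id
      (delete⇒contract G v) stale-edge (λ unique → ⊥-elim (unique u shared))
    where
    -- The neighbourhood of v is a clique in G/v, so all of it but u₀ needs new colours.
    Fresh : Fin m → Set
    Fresh z = Neighbour z × punchIn v z ≢ punchIn v u₀

    fresh? : Decidable Fresh
    fresh? z = Adj? G v (punchIn v z) ×-dec ¬? (punchIn v z ≟ punchIn v u₀)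

    stale-is-u₀ : ∀ {z} → ¬ Fresh z → Neighbour z → z ≡ u₀
    stale-is-u₀ {z} ¬p z~v with punchIn v z ≟ punchIn v u₀
    ... | yes same = punchIn-inj same
    ... | no differ = ⊥-elim (¬p (z~v , differ))

    stale-edge : ∀ {x y} → ¬ Fresh x → ¬ Fresh y → Adj (contract G v) x y → Adj (delete G v) x y
    stale-edge {x} {y} ¬p ¬q a with contract⇒delete⊎common G v a
    ... | inj₁ a′ = a′
    ... | inj₂ (x~v , y~v) = ⊥-elim (Adj-irrefl (contract G v) (subst (Adj (contract G v) x) y≡x a))
      where
      y≡x : y ≡ x
      y≡x = trans (stale-is-u₀ ¬q y~v) (sym (stale-is-u₀ ¬p x~v))

  contract-unique : ∀ {c} {f : Fin (suc m) → Fin (suc c)} → IsTDColoring G f →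
    (∀ z → f (punchIn v z) ≢ f v) →
    (∀ {y} → Neighbour y → ∃ λ s → s ≢ y × Neighbour s) →
    HasTDColoring (contract G v) (c + suc d)
  contract-unique {f = f} f-td unique another =
    Recolouring.hasTDColoring {G = G} {v = v} {f = f} f-td (contract G v)
      (λ z → Adj? G v (punchIn v z)) (Ranking-∘ punchIn-inj N)
      (dropColour {f = f} unique) (dropColour-reflects {f = f} unique)
      (delete⇒contract G v) stale-edge rescue
    where
    stale-edge : ∀ {x y} → ¬ Neighbour x → ¬ Neighbour y →
      Adj (contract G v) x y → Adj (delete G v) x y
    stale-edge ¬p _ a with contract⇒delete⊎common G v a
    ... | inj₁ a′ = a′
    ... | inj₂ (x~v , _) = ⊥-elim (¬p x~v)

    rescue : (∀ z → f (punchIn v z) ≢ f v) →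
      ∀ {y} → Adj G (punchIn v y) v → ∃ λ w → Neighbour w × Adj (contract G v) y w
    rescue _ y~v with another (Adj-sym G y~v)
    ... | s , s≢y , s~v = s , s~v , common⇒contract G v (s≢y ∘ sym) (Adj-sym G y~v) s~v

  delete-colouring : ∀ {c} {f : Fin (suc m) → Fin c} → IsTDColoring G f →
    NoIsolated (delete G v) →
    HasTDColoring (delete G v) (c + d)
  delete-colouring {zero}  {f} _ _ with () ← f v
  delete-colouring {suc c} {f} f-td D-noIso with any? (λ z → f (punchIn v z) ≟ f v)
  ... | yes shared =
    HasTDColoring-mono {G = delete G v} (+-monoʳ-≤ (suc c) z≤n) (delete-shared f-td shared)
  ... | no unique =
    HasTDColoring-mono {G = delete G v} (≤-reflexive (+-suc c d))
      (delete-unique f-td (λ z e → unique (z , e)) D-noIso)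

  contract-colouring : ∀ {c} {f : Fin (suc m) → Fin c} → IsTDColoring G f →
    NoIsolated (delete G v) →
    HasTDColoring (contract G v) (c + d)
  contract-colouring {zero}  {f} _ _ with () ← f v
  contract-colouring {suc c} {f} f-td D-noIso
    with any? (λ z → f (punchIn v z) ≟ f v)
       | any? (λ x → any? (λ y →
           ¬? (x ≟ y) ×-dec Adj? G v (punchIn v x) ×-dec Adj? G v (punchIn v y)))
  ... | yes shared | _ = contract-shared f-td shared
  ... | no unique | yes (x , y , x≢y , x~v , y~v) =
    HasTDColoring-mono {G = contract G v} (≤-reflexive (+-suc c d))
      (contract-unique f-td (λ z e → unique (z , e)) another)
    where
    another : ∀ {z} → Neighbour z → ∃ λ s → s ≢ z × Neighbour s
    another {z} _ with x ≟ z
    ... | yes refl = y , x≢y ∘ sym , y~v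
    ... | no x≢z = x , x≢z , x~v
  ... | no _ | no ¬two =
    HasTDColoring-resp {H = delete G v} {contract G v} (delete⇒contract G v) contract⇒delete
      (delete-colouring f-td D-noIso)
    where
    contract⇒delete : ∀ {x y} → Adj (contract G v) x y → Adj (delete G v) x y
    contract⇒delete {x} {y} a with contract⇒delete⊎common G v a
    ... | inj₁ a′ = a′
    ... | inj₂ (x~v , y~v) =
      ⊥-elim (¬two (x , y , (λ { refl → Adj-irrefl (contract G v) a }) , x~v , y~v))

module Extension {m k} {G : Graph (suc m)} {v : Fin (suc m)} {H : Graph m} {h : Fin m → Fin k}
  (h-td : IsTDColoring H h)
  (edge-kept : ∀ {x y} → Adj G (punchIn v x) (punchIn v y) → Adj H x y)
  (edge-lifted : ∀ {y z} → ¬ Adj G v (punchIn v y) → Adj H y z → Adj G (punchIn v y) (punchIn v z))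
  {u : Fin m} (u-adj : Adj G v (punchIn v u))
  where

  colour : Fin m → Fin (2 + k)
  colour z with z ≟ u
  ... | yes _ = suc zero
  ... | no _  = suc (suc (h z))

  g : Fin (suc m) → Fin (2 + k)
  g = insertAt colour v zero

  colour-cover : ∀ z → z ≡ u × colour z ≡ suc zero ⊎ z ≢ u × colour z ≡ suc (suc (h z))
  colour-cover z with z ≟ u
  ... | yes z≡u = inj₁ (z≡u , refl)
  ... | no z≢u  = inj₂ (z≢u , refl)

  g-v : g v ≡ zero
  g-v = insertAt-lookup colour v zero

  g-punchIn : ∀ z → g (punchIn v z) ≡ colour z
  g-punchIn = insertAt-punchIn colour v zero

  g-u : g (punchIn v u) ≡ suc zero
  g-u with colour-cover u
  ... | inj₁ (_ , coloured) = trans (g-punchIn u) coloured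
  ... | inj₂ (u≢u , _) = ⊥-elim (u≢u refl)

  g-old : ∀ {z} → z ≢ u → g (punchIn v z) ≡ suc (suc (h z))
  g-old {z} z≢u with colour-cover z
  ... | inj₁ (z≡u , _) = ⊥-elim (z≢u z≡u)
  ... | inj₂ (_ , coloured) = trans (g-punchIn z) coloured

  class-v : ∀ {x} → g x ≡ zero → x ≡ v
  class-v {x} gx with punchIn-cover v x
  ... | inj₁ x≡v = x≡v
  ... | inj₂ (z , refl) with colour-cover z | trans (sym (g-punchIn z)) gx
  ...   | inj₁ (_ , coloured) | eq with () ← trans (sym coloured) eq
  ...   | inj₂ (_ , coloured) | eq with () ← trans (sym coloured) eq

  class-u : ∀ {x} → g x ≡ suc zero → x ≡ punchIn v u
  class-u {x} gx with punchIn-cover v x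
  ... | inj₁ refl with () ← trans (sym g-v) gx
  ... | inj₂ (z , refl) with colour-cover z | trans (sym (g-punchIn z)) gx
  ...   | inj₁ (z≡u , _) | _ = cong (punchIn v) z≡u
  ...   | inj₂ (_ , coloured) | eq with () ← trans (sym coloured) eq

  class-old : ∀ {x i} → g x ≡ suc (suc i) → ∃ λ z → x ≡ punchIn v z × h z ≡ i
  class-old {x} gx with punchIn-cover v x
  ... | inj₁ refl with () ← trans (sym g-v) gx
  ... | inj₂ (z , refl) with colour-cover z | trans (sym (g-punchIn z)) gx
  ...   | inj₁ (_ , coloured) | eq with () ← trans (sym coloured) eq
  ...   | inj₂ (_ , coloured) | eq = z , refl , suc-injective (suc-injective (trans (sym coloured) eq))

  only-v : ∀ {x} → g x ≡ g v → x ≡ v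
  only-v e = class-v (trans e g-v)

  only-u : ∀ {x} → g x ≡ g (punchIn v u) → x ≡ punchIn v u
  only-u e = class-u (trans e g-u)

  same-colour : ∀ {x y} → g x ≡ g y →
    x ≡ y ⊎ ∃₂ λ z z' → x ≡ punchIn v z × y ≡ punchIn v z' × h z ≡ h z'
  same-colour {x} {y} eq with g x in gx
  ... | zero = inj₁ (trans (class-v gx) (sym (class-v (sym eq))))
  ... | suc zero = inj₁ (trans (class-u gx) (sym (class-u (sym eq))))
  ... | suc (suc i) with class-old gx | class-old (sym eq)
  ...   | z , x≡z , hz | z' , y≡z' , hz' = inj₂ (z , z' , x≡z , y≡z' , trans hz (sym hz'))

  proper : Proper G g
  proper x y a eq with same-colour eq
  ... | inj₁ refl = Adj-irrefl G a
  ... | inj₂ (z , z' , refl , refl , same) = proj₁ h-td z z' (edge-kept a) same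

  dominates-old : ∀ {z} → ¬ Adj G v (punchIn v z) → ∃ (DominatesClass G g (punchIn v z))
  -- Recolouring u shrinks its h-class; if u was the witness of the class z dominates,
  -- z dominates {u} instead.
  dominates-old {z} z≁v with proj₂ h-td z
  ... | i , i≢ , (z₀ , z₀∈i) , adj-i with z₀ ≟ u
  ...   | yes refl =
    g (punchIn v u) , dominates-unique {G = G} proper (edge-lifted z≁v (adj-i z₀ z₀∈i)) only-u
  ...   | no z₀≢u  = suc (suc i) , distinct , (punchIn v z₀ , z₀-coloured) , member
    where
    z₀-coloured : g (punchIn v z₀) ≡ suc (suc i)
    z₀-coloured = trans (g-old z₀≢u) (cong (λ j → suc (suc j)) z₀∈i)
    distinct : suc (suc i) ≢ g (punchIn v z)
    distinct eq = i≢ (suc-injective (suc-injective (trans eq (g-old (λ { refl → z≁v u-adj })))))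
    member : ∀ y → g y ≡ suc (suc i) → Adj G (punchIn v z) y
    member y gy with class-old gy
    ... | z' , refl , z'∈i = edge-lifted z≁v (adj-i z' z'∈i)

  dominate : ∀ x → ∃ (DominatesClass G g x)
  dominate x with punchIn-cover v x
  ... | inj₁ refl = g (punchIn v u) , dominates-unique {G = G} proper u-adj only-u
  ... | inj₂ (z , refl) with Adj? G v (punchIn v z)
  ...   | yes z~v = g v , dominates-unique {G = G} proper (Adj-sym G z~v) only-v
  ...   | no z≁v  = dominates-old z≁v

  hasTDColoring : HasTDColoring G (2 + k)
  hasTDColoring = g , proper , dominate

delete-extension : ∀ {m k} {G : Graph (suc m)} {v u} → Adj G v (punchIn v u) →
  HasTDColoring (delete G v) k → HasTDColoring G (2 + k)
delete-extension {G = G} {v} u-adj (h , h-td) =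
  Extension.hasTDColoring {G = G} {v = v} {H = delete G v} h-td id (λ _ → id) u-adj

contract-extension : ∀ {m k} {G : Graph (suc m)} {v u} → Adj G v (punchIn v u) →
  HasTDColoring (contract G v) k → HasTDColoring G (2 + k)
contract-extension {G = G} {v} u-adj (h , h-td) =
  Extension.hasTDColoring {G = G} {v = v} {H = contract G v} h-td (delete⇒contract G v) lifted u-adj
  where
  lifted : ∀ {y z} → ¬ Adj G v (punchIn v y) → Adj (contract G v) y z → Adj (delete G v) y z
  lifted y≁v a with contract⇒delete⊎common G v a
  ... | inj₁ a′ = a′
  ... | inj₂ (y~v , _) = ⊥-elim (y≁v y~v)

lower-sum : ∀ {a b c d} → a ≤ c + d → b ≤ c + d → a + b + 2 ≤ 2 * c + 2 * suc d
lower-sum {a} {b} {c} {d} a≤ b≤ =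
  subst₂ _≤_ (lhs a b) (rhs c d) (+-mono-≤ (s≤s a≤) (s≤s b≤))
  where
  lhs : ∀ a b → suc a + suc b ≡ a + b + 2
  lhs = solve-∀
  rhs : ∀ c d → suc (c + d) + suc (c + d) ≡ 2 * c + 2 * suc d
  rhs = solve-∀

upper-sum : ∀ {a b c} → c ≤ 2 + a → c ≤ 2 + b → 2 * c ≤ a + b + 4
upper-sum {a} {b} {c} c≤a c≤b = subst (2 * c ≤_) (rhs a b) (+-mono-≤ c≤a (+-mono-≤ c≤b z≤n))
  where
  rhs : ∀ a b → (2 + a) + ((2 + b) + 0) ≡ a + b + 4
  rhs = solve-∀

χ-lower : ∀ {m} {G : Graph (suc m)} {v a b c} → NoIsolated G → NoIsolated (delete G v) →
  IsTDChromatic (delete G v) a → IsTDChromatic (contract G v) b → HasTDColoring G c →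
  a + b + 2 ≤ 2 * c + 2 * deg G v
χ-lower {G = G} {v} G-noIso D-noIso χD χC (f , f-td) with punchIn-neighbour G v (G-noIso v)
... | u , u-adj with neighbourhood-ranking G v u-adj
...   | d , deg≡ , N rewrite deg≡ =
  lower-sum (IsTDChromatic-minimal {G = delete G v} χD (delete-colouring {f = f} f-td D-noIso))
            (IsTDChromatic-minimal {G = contract G v} χC (contract-colouring {f = f} f-td D-noIso))
  where open LowerBound G v N u u-adj

χ-upper : ∀ {m} {G : Graph (suc m)} {v a b c} → NoIsolated G →
  HasTDColoring (delete G v) a → HasTDColoring (contract G v) b → IsTDChromatic G c →
  2 * c ≤ a + b + 4
χ-upper {G = G} {v} G-noIso hD hC χG with punchIn-neighbour G v (G-noIso v)
... | u , u-adj =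
  upper-sum (IsTDChromatic-minimal {G = G} χG (delete-extension {G = G} {v} u-adj hD))
            (IsTDChromatic-minimal {G = G} χG (contract-extension {G = G} {v} u-adj hC))

corollary3p4 : ∀ {m} (G : Graph (suc m)) (v : Fin (suc m)) →
    Connected G → ¬ IsCutVertex G v →
    NoIsolated G → NoIsolated (delete G v) → NoIsolated (contract G v) →
    (a b c : ℕ) →
    IsTDChromatic (delete G v) a → IsTDChromatic (contract G v) b → IsTDChromatic G c →
    (a + b + 2 ≤ 2 * c + 2 * deg G v) × (2 * c ≤ a + b + 4)
corollary3p4 G v _ _ G-noIso D-noIso _ a b c χD χC χG =
  χ-lower {G = G} {v} G-noIso D-noIso χD χC (proj₁ χG) ,
  χ-upper {G = G} {v} G-noIso (proj₁ χD) (proj₁ χC) χG
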